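{- Let $\xi = e^{2\pi \mathrm{i}/3}$. For all integers $k \ge 2$ and $j \in \{0,1,2,3\}$, $$[t^{2k-j}]\,\frac{(1-t)^{k-2}(1-\xi t)^{k-1}}{1-\xi^2 t} = 3^{k-2}(\xi - 1)\xi^{k+j-1},$$ and $$[t^{2k-j}]\,\frac{(1-t)^{k-2}(1-\xi^2 t)^{k-1}}{1-\xi t} = 3^{k-2}(1-\xi)\xi^{2k-j},$$ where $[t^m]$ denotes the coefficient of $t^m$ in the formal power series expansion. -}

module Defs where

open import Data.Nat as ℕ using (ℕ; zero; suc; _∸_)
open import Data.Integer as ℤ using (ℤ; +_)

-- Eisenstein integers ℤ[ξ], ξ = e^{2πi/3}, represented as a + b·ξ
-- (unique representation), with ξ² = -1 - ξ.
record ℤξ : Set where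
  constructor _+_ξ
  field
    re : ℤ
    im : ℤ

infixl 6 _⊕_ _⊖_
infixl 7 _⊗_
infixl 7 _⋆_
infix 8 _^_ _^ₛ_

_⊕_ : ℤξ → ℤξ → ℤξ
(a + b ξ) ⊕ (c + d ξ) = (a ℤ.+ c) + (b ℤ.+ d) ξ

⊖_ : ℤξ → ℤξ
⊖ (a + b ξ) = (ℤ.- a) + (ℤ.- b) ξ

_⊖_ : ℤξ → ℤξ → ℤξ
x ⊖ y = x ⊕ (⊖ y)

-- (a + bξ)(c + dξ) = ac + (ad + bc)ξ + bd ξ² = (ac - bd) + (ad + bc - bd)ξ
_⊗_ : ℤξ → ℤξ → ℤξ
(a + b ξ) ⊗ (c + d ξ) = (a ℤ.* c ℤ.- b ℤ.* d) + (a ℤ.* d ℤ.+ b ℤ.* c ℤ.- b ℤ.* d) ξ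

𝟘 𝟙 ξ : ℤξ
𝟘 = (+ 0) + (+ 0) ξ
𝟙 = (+ 1) + (+ 0) ξ
ξ = (+ 0) + (+ 1) ξ

ι : ℤ → ℤξ
ι a = a + (+ 0) ξ

_^_ : ℤξ → ℕ → ℤξ
x ^ zero = 𝟙
x ^ suc n = x ⊗ (x ^ n)

FPS : Set
FPS = ℕ → ℤξ

coeff : ℕ → FPS → ℤξ
coeff m f = f m

sumBelow : ℕ → (ℕ → ℤξ) → ℤξ
sumBelow zero f = 𝟘
sumBelow (suc n) f = sumBelow n f ⊕ f n

_⋆_ : FPS → FPS → FPS
(f ⋆ g) n = sumBelow (suc n) (λ i → f i ⊗ g (n ∸ i))

one : FPS
one zero = 𝟙
one (suc n) = 𝟘

_^ₛ_ : FPS → ℕ → FPS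
f ^ₛ zero = one
f ^ₛ suc n = f ⋆ (f ^ₛ n)

1-_t : ℤξ → FPS
(1- c t) zero = 𝟙
(1- c t) (suc zero) = ⊖ c
(1- c t) (suc (suc n)) = 𝟘

-- 1/(1 - c·t) = Σ_n c^n t^n, the inverse of (1 - c·t) in ℤ[ξ][[t]]
inv1-_t : ℤξ → FPS
(inv1- c t) n = c ^ n

3^ : ℕ → ℤξ
3^ n = ι ((+ 3) ℤ.^ n)

-- Multiplying a power series by 1 - d·t turns a tail m ↦ A·cᵐ into the tail
-- m ↦ A·(1 - d·c⁻¹)·cᵐ, starting one index later.  The coefficients of
-- 1/(1 - c·t) are cᵐ, so if ω is a root of 1 + x + x² and c = ω² = ω⁻¹, then
-- (1 - t)ⁿ(1 - ω·t)ⁿ⁺¹/(1 - c·t) has coefficients 3ⁿ·(1 - ω²)·cᵐ for m ≥ 2n + 1,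
-- because (1 - ω)(1 - ω²) = 3.  For ω = ξ² (so c = ξ) this is the second
-- formula; for ω = ξ the first follows by reducing exponents of ξ modulo 3.
{-# OPTIONS --safe #-}
module Submission where

open import Defs
open import Algebra.Bundles using (CommutativeRing)
import Algebra.Properties.CommutativeSemigroup as CommutativeSemigroupProperties
import Algebra.Properties.Semigroup as SemigroupProperties
open import Data.Integer as ℤ using (+_)
import Data.Integer.Properties as ℤP
import Data.Integer.Tactic.RingSolver as ℤ-Solver
open import Data.Maybe using (just; nothing)
open import Data.Nat.Properties
  using (≤-refl; <⇒≤; ≤⇒≤′; ≤′⇒≤; m≤n⇒m≤1+n; n∸n≡0; +-suc; +-comm; *-suc; *-zeroʳ; *-distribˡ-+;
         +-∸-assoc; m<m+n; m<n⇒0<n∸m)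
open import Data.Product using (_×_; _,_)
open import Function using (_∘_)
open import Relation.Binary.PropositionalEquality
import Relation.Binary.Reasoning.Setoid as SetoidReasoning
import Tactic.RingSolver.Core.AlmostCommutativeRing as ACR
open import Tactic.RingSolver using (solve-∀)

module ℤξ-Ring where
  open ℤξ using (re; im)

  componentwise : ∀ {x y} → re x ≡ re y → im x ≡ im y → x ≡ y
  componentwise = cong₂ _+_ξ

  ⊕-assoc : ∀ x y z → (x ⊕ y) ⊕ z ≡ x ⊕ (y ⊕ z)
  ⊕-assoc x y z = componentwise (ℤP.+-assoc (re x) (re y) (re z)) (ℤP.+-assoc (im x) (im y) (im z))

  ⊕-comm : ∀ x y → x ⊕ y ≡ y ⊕ x
  ⊕-comm x y = componentwise (ℤP.+-comm (re x) (re y)) (ℤP.+-comm (im x) (im y))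

  ⊕-identityˡ : ∀ x → 𝟘 ⊕ x ≡ x
  ⊕-identityˡ x = componentwise (ℤP.+-identityˡ (re x)) (ℤP.+-identityˡ (im x))

  ⊕-identityʳ : ∀ x → x ⊕ 𝟘 ≡ x
  ⊕-identityʳ x = trans (⊕-comm x 𝟘) (⊕-identityˡ x)

  ⊖-inverseˡ : ∀ x → ⊖ x ⊕ x ≡ 𝟘
  ⊖-inverseˡ x = componentwise (ℤP.+-inverseˡ (re x)) (ℤP.+-inverseˡ (im x))

  ⊖-inverseʳ : ∀ x → x ⊕ ⊖ x ≡ 𝟘
  ⊖-inverseʳ x = trans (⊕-comm x (⊖ x)) (⊖-inverseˡ x)

  ⊗-comm : ∀ x y → x ⊗ y ≡ y ⊗ x
  ⊗-comm x y = componentwise (re-comm (re x) (im x) (re y) (im y)) (im-comm (re x) (im x) (re y) (im y))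
    where
    open ℤ using (_+_; _*_; _-_)
    re-comm : ∀ a b c d → a * c - b * d ≡ c * a - d * b
    re-comm = ℤ-Solver.solve-∀
    im-comm : ∀ a b c d → a * d + b * c - b * d ≡ c * b + d * a - d * b
    im-comm = ℤ-Solver.solve-∀

  ⊗-assoc : ∀ x y z → (x ⊗ y) ⊗ z ≡ x ⊗ (y ⊗ z)
  ⊗-assoc x y z = componentwise (re-assoc (re x) (im x) (re y) (im y) (re z) (im z))
                       (im-assoc (re x) (im x) (re y) (im y) (re z) (im z))
    where
    open ℤ using (_+_; _*_; _-_)
    re-assoc : ∀ a b c d e f →
               (a * c - b * d) * e - (a * d + b * c - b * d) * f ≡ a * (c * e - d * f) - b * (c * f + d * e - d * f)
    re-assoc = ℤ-Solver.solve-∀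
    im-assoc : ∀ a b c d e f →
               (a * c - b * d) * f + (a * d + b * c - b * d) * e - (a * d + b * c - b * d) * f
               ≡ a * (c * f + d * e - d * f) + b * (c * e - d * f) - b * (c * f + d * e - d * f)
    im-assoc = ℤ-Solver.solve-∀

  ⊗-identityˡ : ∀ x → 𝟙 ⊗ x ≡ x
  ⊗-identityˡ x = componentwise (re-identity (re x) (im x)) (im-identity (re x) (im x))
    where
    open ℤ using (_+_; _*_; _-_)
    re-identity : ∀ a b → + 1 * a - + 0 * b ≡ a
    re-identity = ℤ-Solver.solve-∀
    im-identity : ∀ a b → + 1 * b + + 0 * a - + 0 * b ≡ b
    im-identity = ℤ-Solver.solve-∀

  ⊗-identityʳ : ∀ x → x ⊗ 𝟙 ≡ x
  ⊗-identityʳ x = trans (⊗-comm x 𝟙) (⊗-identityˡ x)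

  ⊗-distribˡ-⊕ : ∀ x y z → x ⊗ (y ⊕ z) ≡ x ⊗ y ⊕ x ⊗ z
  ⊗-distribˡ-⊕ x y z = componentwise (re-distrib (re x) (im x) (re y) (im y) (re z) (im z))
                            (im-distrib (re x) (im x) (re y) (im y) (re z) (im z))
    where
    open ℤ using (_+_; _*_; _-_)
    re-distrib : ∀ a b c d e f → a * (c + e) - b * (d + f) ≡ (a * c - b * d) + (a * e - b * f)
    re-distrib = ℤ-Solver.solve-∀
    im-distrib : ∀ a b c d e f →
                 a * (d + f) + b * (c + e) - b * (d + f) ≡ (a * d + b * c - b * d) + (a * f + b * e - b * f)
    im-distrib = ℤ-Solver.solve-∀

  ⊗-distribʳ-⊕ : ∀ x y z → (y ⊕ z) ⊗ x ≡ y ⊗ x ⊕ z ⊗ x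
  ⊗-distribʳ-⊕ x y z = begin
    (y ⊕ z) ⊗ x     ≡⟨ ⊗-comm (y ⊕ z) x ⟩
    x ⊗ (y ⊕ z)     ≡⟨ ⊗-distribˡ-⊕ x y z ⟩
    x ⊗ y ⊕ x ⊗ z   ≡⟨ cong₂ _⊕_ (⊗-comm x y) (⊗-comm x z) ⟩
    y ⊗ x ⊕ z ⊗ x   ∎
    where open ≡-Reasoning

  ℤξ-commutativeRing : CommutativeRing _ _
  ℤξ-commutativeRing = record
    { Carrier = ℤξ ; _≈_ = _≡_ ; _+_ = _⊕_ ; _*_ = _⊗_ ; -_ = λ x → ⊖ x ; 0# = 𝟘 ; 1# = 𝟙
    ; isCommutativeRing = record
      { isRing = record
        { +-isAbelianGroup = record
          { isGroup = record
            { isMonoid = record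
              { isSemigroup = record
                { isMagma = record { isEquivalence = isEquivalence ; ∙-cong = cong₂ _⊕_ }
                ; assoc = ⊕-assoc }
              ; identity = ⊕-identityˡ , ⊕-identityʳ }
            ; inverse = ⊖-inverseˡ , ⊖-inverseʳ
            ; ⁻¹-cong = cong (λ x → ⊖ x) }
          ; comm = ⊕-comm }
        ; *-cong = cong₂ _⊗_
        ; *-assoc = ⊗-assoc
        ; *-identity = ⊗-identityˡ , ⊗-identityʳ
        ; distrib = ⊗-distribˡ-⊕ , ⊗-distribʳ-⊕ }
      ; *-comm = ⊗-comm } }

  ι-homo-⊗ : ∀ a b → ι (a ℤ.* b) ≡ ι a ⊗ ι b
  ι-homo-⊗ a b = componentwise (re-homo a b) (im-homo a b)
    where
    open ℤ using (_+_; _*_; _-_)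
    re-homo : ∀ a b → a * b ≡ a * b - + 0 * + 0
    re-homo = ℤ-Solver.solve-∀
    im-homo : ∀ a b → + 0 ≡ a * + 0 + + 0 * b - + 0 * + 0
    im-homo = ℤ-Solver.solve-∀

open ℤξ-Ring

open import Data.Nat using (ℕ; zero; suc; _≤_; _<_; _≤′_; ≤′-refl; ≤′-step; _+_; _*_; _∸_; z≤n; s≤s)

ℤξ-ring : ACR.AlmostCommutativeRing _ _
ℤξ-ring = ACR.fromCommutativeRing ℤξ-commutativeRing λ where
  ((+ 0) + (+ 0) ξ) → just refl
  _                 → nothing

open CommutativeSemigroupProperties (CommutativeRing.*-commutativeSemigroup ℤξ-commutativeRing)
  using (x∙yz≈y∙xz)
open SemigroupProperties (CommutativeRing.*-semigroup ℤξ-commutativeRing)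
  using (uv≈wx⇒yu∙v≈yw∙x)

⊗-zeroˡ : ∀ x → 𝟘 ⊗ x ≡ 𝟘
⊗-zeroˡ = solve-∀ ℤξ-ring

3^-suc : ∀ n → 3^ (suc n) ≡ ι (+ 3) ⊗ 3^ n
3^-suc n = ι-homo-⊗ (+ 3) ((+ 3) ℤ.^ n)

^-homo-⊗ : ∀ x m n → x ^ (m + n) ≡ x ^ m ⊗ x ^ n
^-homo-⊗ x zero    n = sym (⊗-identityˡ (x ^ n))
^-homo-⊗ x (suc m) n = trans (cong (x ⊗_) (^-homo-⊗ x m n)) (sym (⊗-assoc x (x ^ m) (x ^ n)))

^-assocʳ : ∀ x m n → (x ^ m) ^ n ≡ x ^ (m * n)
^-assocʳ x m zero    = cong (x ^_) (sym (*-zeroʳ m))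
^-assocʳ x m (suc n) = begin
  x ^ m ⊗ (x ^ m) ^ n    ≡⟨ cong (x ^ m ⊗_) (^-assocʳ x m n) ⟩
  x ^ m ⊗ x ^ (m * n)    ≡⟨ sym (^-homo-⊗ x m (m * n)) ⟩
  x ^ (m + m * n)        ≡⟨ cong (x ^_) (sym (*-suc m n)) ⟩
  x ^ (m * suc n)        ∎
  where open ≡-Reasoning

sumBelow-cong : ∀ n {f g : ℕ → ℤξ} → f ≗ g → sumBelow n f ≡ sumBelow n g
sumBelow-cong zero    f≗g = refl
sumBelow-cong (suc n) f≗g = cong₂ _⊕_ (sumBelow-cong n f≗g) (f≗g n)

sumBelow-vanishing : ∀ m {n f} → m ≤ n → (∀ {i} → m ≤ i → f i ≡ 𝟘) → sumBelow n f ≡ sumBelow m f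
sumBelow-vanishing m {f = f} m≤n vanish = go (≤⇒≤′ m≤n)
  where
  open ≡-Reasoning
  go : ∀ {n} → m ≤′ n → sumBelow n f ≡ sumBelow m f
  go ≤′-refl = refl
  go (≤′-step {n} m≤′n) = begin
    sumBelow n f ⊕ f n  ≡⟨ cong (sumBelow n f ⊕_) (vanish (≤′⇒≤ m≤′n)) ⟩
    sumBelow n f ⊕ 𝟘    ≡⟨ ⊕-identityʳ (sumBelow n f) ⟩
    sumBelow n f        ≡⟨ go m≤′n ⟩
    sumBelow m f        ∎

infixr 8 [1-_t]·_

[1-_t]·_ : ℤξ → FPS → FPS
([1- c t]· f) zero    = f zero
([1- c t]· f) (suc n) = f (suc n) ⊖ c ⊗ f n

[1-t]·-cong : ∀ c {f g : FPS} → f ≗ g → [1- c t]· f ≗ [1- c t]· g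
[1-t]·-cong c f≗g zero    = f≗g zero
[1-t]·-cong c f≗g (suc n) = cong₂ (λ x y → x ⊖ c ⊗ y) (f≗g (suc n)) (f≗g n)

[1-t]·-at-zero : ∀ c (f : FPS) {m} → m ≡ 0 → ([1- c t]· f) m ≡ f m
[1-t]·-at-zero c f refl = refl

[1-t]·-at-suc : ∀ c (f : FPS) {m n} → m ≡ suc n → ([1- c t]· f) m ≡ f m ⊖ c ⊗ f n
[1-t]·-at-suc c f refl = refl

⋆-cong : ∀ {f f′ g g′} → f ≗ f′ → g ≗ g′ → f ⋆ g ≗ f′ ⋆ g′
⋆-cong f≗f′ g≗g′ n = sumBelow-cong (suc n) (λ i → cong₂ _⊗_ (f≗f′ i) (g≗g′ (n ∸ i)))

⋆-congˡ : ∀ {f f′} g → f ≗ f′ → f ⋆ g ≗ f′ ⋆ g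
⋆-congˡ g f≗f′ = ⋆-cong {g = g} f≗f′ (λ _ → refl)

⋆-identityˡ : ∀ (f : FPS) → one ⋆ f ≗ f
⋆-identityˡ f n = begin
  sumBelow (suc n) (λ i → one i ⊗ f (n ∸ i))  ≡⟨ sumBelow-vanishing 1 {suc n} (s≤s z≤n) vanish ⟩
  𝟘 ⊕ 𝟙 ⊗ f n                                 ≡⟨ unit (f n) ⟩
  f n                                         ∎
  where
  open ≡-Reasoning
  vanish : ∀ {i} → 1 ≤ i → one i ⊗ f (n ∸ i) ≡ 𝟘
  vanish {suc i} _ = ⊗-zeroˡ (f (n ∸ suc i))
  unit : ∀ x → 𝟘 ⊕ 𝟙 ⊗ x ≡ x
  unit = solve-∀ ℤξ-ring

1-t-⋆ : ∀ c (f : FPS) → (1- c t) ⋆ f ≗ [1- c t]· f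
1-t-⋆ c f zero    = ⋆-identityˡ f zero
1-t-⋆ c f (suc n) = begin
  sumBelow (2 + n) (λ i → (1- c t) i ⊗ f (suc n ∸ i))  ≡⟨ sumBelow-vanishing 2 {2 + n} (s≤s (s≤s z≤n)) vanish ⟩
  (𝟘 ⊕ 𝟙 ⊗ f (suc n)) ⊕ ⊖ c ⊗ f n                      ≡⟨ linear c (f (suc n)) (f n) ⟩
  f (suc n) ⊖ c ⊗ f n                                  ∎
  where
  open ≡-Reasoning
  vanish : ∀ {i} → 2 ≤ i → (1- c t) i ⊗ f (suc n ∸ i) ≡ 𝟘
  vanish {suc (suc i)} _          = ⊗-zeroˡ (f (n ∸ suc i))
  vanish {suc zero}    (s≤s ())
  linear : ∀ c x y → (𝟘 ⊕ 𝟙 ⊗ x) ⊕ ⊖ c ⊗ y ≡ x ⊖ c ⊗ y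
  linear = solve-∀ ℤξ-ring

sumBelow-[1-t]·ˡ : ∀ c (f w : FPS) N →
  sumBelow (suc N) (λ i → ([1- c t]· f) i ⊗ w i)
  ≡ sumBelow (suc N) (λ i → f i ⊗ w i) ⊖ c ⊗ sumBelow N (λ i → f i ⊗ w (suc i))
sumBelow-[1-t]·ˡ c f w zero    = sym (subtract-zero (𝟘 ⊕ f 0 ⊗ w 0) c)
  where
  subtract-zero : ∀ x c → x ⊖ c ⊗ 𝟘 ≡ x
  subtract-zero = solve-∀ ℤξ-ring
sumBelow-[1-t]·ˡ c f w (suc N) = begin
  sumBelow (suc N) (λ i → ([1- c t]· f) i ⊗ w i) ⊕ (f (suc N) ⊖ c ⊗ f N) ⊗ w (suc N)
    ≡⟨ cong (_⊕ (f (suc N) ⊖ c ⊗ f N) ⊗ w (suc N)) (sumBelow-[1-t]·ˡ c f w N) ⟩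
  (S ⊖ c ⊗ S′) ⊕ (f (suc N) ⊖ c ⊗ f N) ⊗ w (suc N)
    ≡⟨ regroup S S′ (f (suc N)) (f N) (w (suc N)) c ⟩
  (S ⊕ f (suc N) ⊗ w (suc N)) ⊖ c ⊗ (S′ ⊕ f N ⊗ w (suc N))
    ∎
  where
  open ≡-Reasoning
  S S′ : ℤξ
  S  = sumBelow (suc N) (λ i → f i ⊗ w i)
  S′ = sumBelow N (λ i → f i ⊗ w (suc i))
  regroup : ∀ S S′ a b y c → (S ⊖ c ⊗ S′) ⊕ (a ⊖ c ⊗ b) ⊗ y ≡ (S ⊕ a ⊗ y) ⊖ c ⊗ (S′ ⊕ b ⊗ y)
  regroup = solve-∀ ℤξ-ring

[1-t]·-⋆ˡ : ∀ c (f g : FPS) → ([1- c t]· f) ⋆ g ≗ [1- c t]· (f ⋆ g)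
[1-t]·-⋆ˡ c f g zero    = refl
[1-t]·-⋆ˡ c f g (suc n) = sumBelow-[1-t]·ˡ c f (λ i → g (suc n ∸ i)) (suc n)

n∸m≡1+[n∸1+m] : ∀ {m n} → m < n → n ∸ m ≡ suc (n ∸ suc m)
n∸m≡1+[n∸1+m] {zero}  (s≤s _)   = refl
n∸m≡1+[n∸1+m] {suc m} (s≤s m<n) = n∸m≡1+[n∸1+m] m<n

sumBelow-[1-t]·ʳ : ∀ c (f g : FPS) {M N} → M ≤ N →
  sumBelow M (λ i → f i ⊗ ([1- c t]· g) (N ∸ i))
  ≡ sumBelow M (λ i → f i ⊗ g (N ∸ i)) ⊖ c ⊗ sumBelow M (λ i → f i ⊗ g (N ∸ suc i))
sumBelow-[1-t]·ʳ c f g {zero}  _         = zero-minus-zero c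
  where
  zero-minus-zero : ∀ c → 𝟘 ≡ 𝟘 ⊖ c ⊗ 𝟘
  zero-minus-zero = solve-∀ ℤξ-ring
sumBelow-[1-t]·ʳ c f g {suc M} {N} M<N = begin
  sumBelow M (λ i → f i ⊗ ([1- c t]· g) (N ∸ i)) ⊕ f M ⊗ ([1- c t]· g) (N ∸ M)
    ≡⟨ cong₂ _⊕_ (sumBelow-[1-t]·ʳ c f g (<⇒≤ M<N))
                 (cong (f M ⊗_) ([1-t]·-at-suc c g (n∸m≡1+[n∸1+m] M<N))) ⟩
  (S ⊖ c ⊗ S′) ⊕ f M ⊗ (g (N ∸ M) ⊖ c ⊗ g (N ∸ suc M))
    ≡⟨ regroup S S′ (f M) (g (N ∸ M)) (g (N ∸ suc M)) c ⟩
  (S ⊕ f M ⊗ g (N ∸ M)) ⊖ c ⊗ (S′ ⊕ f M ⊗ g (N ∸ suc M))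
    ∎
  where
  open ≡-Reasoning
  S S′ : ℤξ
  S  = sumBelow M (λ i → f i ⊗ g (N ∸ i))
  S′ = sumBelow M (λ i → f i ⊗ g (N ∸ suc i))
  regroup : ∀ S S′ a x y c → (S ⊖ c ⊗ S′) ⊕ a ⊗ (x ⊖ c ⊗ y) ≡ (S ⊕ a ⊗ x) ⊖ c ⊗ (S′ ⊕ a ⊗ y)
  regroup = solve-∀ ℤξ-ring

[1-t]·-⋆ʳ : ∀ c (f g : FPS) → f ⋆ ([1- c t]· g) ≗ [1- c t]· (f ⋆ g)
[1-t]·-⋆ʳ c f g zero    = refl
[1-t]·-⋆ʳ c f g (suc n) = begin
  S ⊕ f (suc n) ⊗ ([1- c t]· g) (n ∸ n)
    ≡⟨ cong₂ _⊕_ (sumBelow-[1-t]·ʳ c f g {suc n} ≤-refl)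
                 (cong (f (suc n) ⊗_) ([1-t]·-at-zero c g (n∸n≡0 n))) ⟩
  (T ⊖ c ⊗ T′) ⊕ f (suc n) ⊗ g (n ∸ n)
    ≡⟨ regroup T T′ (f (suc n) ⊗ g (n ∸ n)) c ⟩
  (T ⊕ f (suc n) ⊗ g (n ∸ n)) ⊖ c ⊗ T′
    ∎
  where
  open ≡-Reasoning
  S T T′ : ℤξ
  S  = sumBelow (suc n) (λ i → f i ⊗ ([1- c t]· g) (suc n ∸ i))
  T  = sumBelow (suc n) (λ i → f i ⊗ g (suc n ∸ i))
  T′ = sumBelow (suc n) (λ i → f i ⊗ g (n ∸ i))
  regroup : ∀ S S′ a c → (S ⊖ c ⊗ S′) ⊕ a ≡ (S ⊕ a) ⊖ c ⊗ S′
  regroup = solve-∀ ℤξ-ring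

G : ℤξ → ℤξ → ℕ → FPS
G b c n = (1- 𝟙 t) ^ₛ n ⋆ (1- b t) ^ₛ suc n ⋆ inv1- c t

module _ {b c : ℤξ} where
  open SetoidReasoning (ℕ →-setoid ℤξ)

  G-zero : G b c 0 ≗ [1- b t]· inv1- c t
  G-zero = begin
    (one ⋆ ((1- b t) ⋆ one)) ⋆ inv1- c t      ≈⟨ ⋆-congˡ (inv1- c t) (⋆-identityˡ ((1- b t) ⋆ one)) ⟩
    ((1- b t) ⋆ one) ⋆ inv1- c t              ≈⟨ ⋆-congˡ (inv1- c t) (1-t-⋆ b one) ⟩
    ([1- b t]· one) ⋆ inv1- c t               ≈⟨ [1-t]·-⋆ˡ b one (inv1- c t) ⟩
    [1- b t]· (one ⋆ inv1- c t)               ≈⟨ [1-t]·-cong b (⋆-identityˡ (inv1- c t)) ⟩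
    [1- b t]· inv1- c t                       ∎

  G-suc : ∀ n → G b c (suc n) ≗ [1- 𝟙 t]· [1- b t]· G b c n
  G-suc n = begin
    ((1- 𝟙 t) ⋆ Aⁿ) ⋆ ((1- b t) ⋆ Bⁿ) ⋆ I     ≈⟨ ⋆-congˡ I (⋆-cong (1-t-⋆ 𝟙 Aⁿ) (1-t-⋆ b Bⁿ)) ⟩
    ([1- 𝟙 t]· Aⁿ) ⋆ ([1- b t]· Bⁿ) ⋆ I       ≈⟨ ⋆-congˡ I ([1-t]·-⋆ˡ 𝟙 Aⁿ ([1- b t]· Bⁿ)) ⟩
    ([1- 𝟙 t]· (Aⁿ ⋆ [1- b t]· Bⁿ)) ⋆ I       ≈⟨ [1-t]·-⋆ˡ 𝟙 (Aⁿ ⋆ [1- b t]· Bⁿ) I ⟩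
    [1- 𝟙 t]· ((Aⁿ ⋆ [1- b t]· Bⁿ) ⋆ I)       ≈⟨ [1-t]·-cong 𝟙 (⋆-congˡ I ([1-t]·-⋆ʳ b Aⁿ Bⁿ)) ⟩
    [1- 𝟙 t]· (([1- b t]· (Aⁿ ⋆ Bⁿ)) ⋆ I)     ≈⟨ [1-t]·-cong 𝟙 ([1-t]·-⋆ˡ b (Aⁿ ⋆ Bⁿ) I) ⟩
    [1- 𝟙 t]· [1- b t]· G b c n               ∎
    where
    Aⁿ Bⁿ I : FPS
    Aⁿ = (1- 𝟙 t) ^ₛ n
    Bⁿ = (1- b t) ^ₛ suc n
    I  = inv1- c t

-- A record rather than a Π-type, so that its indices are found by unification
-- instead of having to be read off through _⊗_.
record GeometricFrom (m₀ : ℕ) (A c : ℤξ) (f : FPS) : Set where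
  constructor geometricFrom
  field
    agrees : ∀ {m} → m₀ ≤ m → f m ≡ A ⊗ c ^ m

open GeometricFrom

inv1-t-geometric : ∀ c → GeometricFrom 0 𝟙 c (inv1- c t)
inv1-t-geometric c = geometricFrom λ {m} _ → sym (⊗-identityˡ (c ^ m))

GeometricFrom-resp : ∀ {m₀ m₁ A B c f g} → f ≗ g → A ≡ B → m₀ ≡ m₁ →
                     GeometricFrom m₀ A c f → GeometricFrom m₁ B c g
GeometricFrom-resp f≗g refl refl geometric =
  geometricFrom λ m₀≤m → trans (sym (f≗g _)) (agrees geometric m₀≤m)

[1-t]·-geometric : ∀ {m₀ A c f} d c⁻¹ → c⁻¹ ⊗ c ≡ 𝟙 → GeometricFrom m₀ A c f →
                   GeometricFrom (suc m₀) (A ⊗ (𝟙 ⊖ d ⊗ c⁻¹)) c ([1- d t]· f)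
[1-t]·-geometric {m₀} {A} {c} {f} d c⁻¹ c⁻¹c≡1 geometric = geometricFrom tail
  where
  open ≡-Reasoning
  factor : ∀ A c c⁻¹ d x → A ⊗ (c ⊗ x) ⊖ d ⊗ (A ⊗ ((c⁻¹ ⊗ c) ⊗ x)) ≡ A ⊗ (𝟙 ⊖ d ⊗ c⁻¹) ⊗ (c ⊗ x)
  factor = solve-∀ ℤξ-ring
  tail : ∀ {m} → suc m₀ ≤ m → ([1- d t]· f) m ≡ A ⊗ (𝟙 ⊖ d ⊗ c⁻¹) ⊗ c ^ m
  tail {suc m} (s≤s m₀≤m) = begin
    f (suc m) ⊖ d ⊗ f m
      ≡⟨ cong₂ (λ x y → x ⊖ d ⊗ y) (agrees geometric (m≤n⇒m≤1+n m₀≤m)) (agrees geometric m₀≤m) ⟩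
    A ⊗ (c ⊗ c ^ m) ⊖ d ⊗ (A ⊗ c ^ m)
      ≡⟨ cong (λ x → A ⊗ (c ⊗ c ^ m) ⊖ d ⊗ (A ⊗ x)) (trans (sym (⊗-identityˡ (c ^ m))) (cong (_⊗ c ^ m) (sym c⁻¹c≡1))) ⟩
    A ⊗ (c ⊗ c ^ m) ⊖ d ⊗ (A ⊗ ((c⁻¹ ⊗ c) ⊗ c ^ m))
      ≡⟨ factor A c c⁻¹ d (c ^ m) ⟩
    A ⊗ (𝟙 ⊖ d ⊗ c⁻¹) ⊗ (c ⊗ c ^ m)
      ∎

PrimitiveCubeRoot : ℤξ → Set
PrimitiveCubeRoot ω = 𝟙 ⊕ ω ⊕ ω ⊗ ω ≡ 𝟘

module _ {ω : ℤξ} (root : PrimitiveCubeRoot ω) where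
  open ≡-Reasoning

  reduce-mod-root : ∀ {x r} q → x ≡ r ⊕ q ⊗ (𝟙 ⊕ ω ⊕ ω ⊗ ω) → x ≡ r
  reduce-mod-root {x} {r} q x≡r+qΦ = begin
    x                               ≡⟨ x≡r+qΦ ⟩
    r ⊕ q ⊗ (𝟙 ⊕ ω ⊕ ω ⊗ ω)         ≡⟨ cong (λ y → r ⊕ q ⊗ y) root ⟩
    r ⊕ q ⊗ 𝟘                       ≡⟨ cancel r q ⟩
    r                               ∎
    where
    cancel : ∀ r q → r ⊕ q ⊗ 𝟘 ≡ r
    cancel = solve-∀ ℤξ-ring

  cube-root-inverse : ω ⊗ ω ^ 2 ≡ 𝟙
  cube-root-inverse = reduce-mod-root (ω ⊖ 𝟙) (identity ω)
    where
    identity : ∀ ω → ω ⊗ (ω ⊗ (ω ⊗ 𝟙)) ≡ 𝟙 ⊕ (ω ⊖ 𝟙) ⊗ (𝟙 ⊕ ω ⊕ ω ⊗ ω)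
    identity = solve-∀ ℤξ-ring

  cube-root-norm : (𝟙 ⊖ ω ⊗ ω) ⊗ (𝟙 ⊖ 𝟙 ⊗ ω) ≡ ι (+ 3)
  cube-root-norm = reduce-mod-root (ω ⊖ ι (+ 2)) (identity ω)
    where
    identity : ∀ ω → (𝟙 ⊖ ω ⊗ ω) ⊗ (𝟙 ⊖ 𝟙 ⊗ ω) ≡ ι (+ 3) ⊕ (ω ⊖ ι (+ 2)) ⊗ (𝟙 ⊕ ω ⊕ ω ⊗ ω)
    identity = solve-∀ ℤξ-ring

  G-geometric : ∀ n → GeometricFrom (suc (2 * n)) (3^ n ⊗ (𝟙 ⊖ ω ⊗ ω)) (ω ^ 2) (G ω (ω ^ 2) n)
  G-geometric zero =
    GeometricFrom-resp (sym ∘ G-zero) refl refl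
      ([1-t]·-geometric ω ω cube-root-inverse (inv1-t-geometric (ω ^ 2)))
  G-geometric (suc n) =
    GeometricFrom-resp (sym ∘ G-suc n) coefficient (cong suc (sym (*-suc 2 n)))
      ([1-t]·-geometric 𝟙 ω cube-root-inverse ([1-t]·-geometric ω ω cube-root-inverse (G-geometric n)))
    where
    coefficient : 3^ n ⊗ (𝟙 ⊖ ω ⊗ ω) ⊗ (𝟙 ⊖ ω ⊗ ω) ⊗ (𝟙 ⊖ 𝟙 ⊗ ω) ≡ 3^ (suc n) ⊗ (𝟙 ⊖ ω ⊗ ω)
    coefficient = begin
      3^ n ⊗ (𝟙 ⊖ ω ⊗ ω) ⊗ (𝟙 ⊖ ω ⊗ ω) ⊗ (𝟙 ⊖ 𝟙 ⊗ ω)    ≡⟨ regroup (3^ n) (𝟙 ⊖ ω ⊗ ω) (𝟙 ⊖ 𝟙 ⊗ ω) ⟩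
      (𝟙 ⊖ ω ⊗ ω) ⊗ (𝟙 ⊖ 𝟙 ⊗ ω) ⊗ 3^ n ⊗ (𝟙 ⊖ ω ⊗ ω)    ≡⟨ cong (λ x → x ⊗ 3^ n ⊗ (𝟙 ⊖ ω ⊗ ω)) cube-root-norm ⟩
      ι (+ 3) ⊗ 3^ n ⊗ (𝟙 ⊖ ω ⊗ ω)                      ≡⟨ cong (_⊗ (𝟙 ⊖ ω ⊗ ω)) (sym (3^-suc n)) ⟩
      3^ (suc n) ⊗ (𝟙 ⊖ ω ⊗ ω)                         ∎
      where
      regroup : ∀ P x y → P ⊗ x ⊗ x ⊗ y ≡ x ⊗ y ⊗ P ⊗ x
      regroup = solve-∀ ℤξ-ring

2[2+n]∸j≡2n+[4∸j] : ∀ n {j} → j ≤ 4 → 2 * (2 + n) ∸ j ≡ 2 * n + (4 ∸ j)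
2[2+n]∸j≡2n+[4∸j] n {j} j≤4 =
  trans (cong (_∸ j) (trans (*-distribˡ-+ 2 2 n) (+-comm 4 (2 * n)))) (+-∸-assoc (2 * n) j≤4)

[1-ξ²]ξ²^[4-j]≡[ξ-1]ξ^[1+j] : ∀ {j} → j ≤ 3 → (𝟙 ⊖ ξ ⊗ ξ) ⊗ (ξ ^ 2) ^ (4 ∸ j) ≡ (ξ ⊖ 𝟙) ⊗ ξ ^ suc j
[1-ξ²]ξ²^[4-j]≡[ξ-1]ξ^[1+j] z≤n                   = refl
[1-ξ²]ξ²^[4-j]≡[ξ-1]ξ^[1+j] (s≤s z≤n)             = refl
[1-ξ²]ξ²^[4-j]≡[ξ-1]ξ^[1+j] (s≤s (s≤s z≤n))       = refl
[1-ξ²]ξ²^[4-j]≡[ξ-1]ξ^[1+j] (s≤s (s≤s (s≤s z≤n))) = refl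

[1-ξ²]ξ²^[2k-j]≡[ξ-1]ξ^[k+j-1] : ∀ n {j} → j ≤ 3 →
  (𝟙 ⊖ ξ ⊗ ξ) ⊗ (ξ ^ 2) ^ (2 * (2 + n) ∸ j) ≡ (ξ ⊖ 𝟙) ⊗ ξ ^ suc (n + j)
[1-ξ²]ξ²^[2k-j]≡[ξ-1]ξ^[k+j-1] n {j} j≤3 = begin
  (𝟙 ⊖ ξ ⊗ ξ) ⊗ (ξ ^ 2) ^ (2 * (2 + n) ∸ j)
    ≡⟨ cong (λ e → (𝟙 ⊖ ξ ⊗ ξ) ⊗ (ξ ^ 2) ^ e) (2[2+n]∸j≡2n+[4∸j] n (m≤n⇒m≤1+n j≤3)) ⟩
  (𝟙 ⊖ ξ ⊗ ξ) ⊗ (ξ ^ 2) ^ (2 * n + (4 ∸ j))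
    ≡⟨ cong ((𝟙 ⊖ ξ ⊗ ξ) ⊗_) (^-homo-⊗ (ξ ^ 2) (2 * n) (4 ∸ j)) ⟩
  (𝟙 ⊖ ξ ⊗ ξ) ⊗ ((ξ ^ 2) ^ (2 * n) ⊗ (ξ ^ 2) ^ (4 ∸ j))
    ≡⟨ cong (λ x → (𝟙 ⊖ ξ ⊗ ξ) ⊗ (x ⊗ (ξ ^ 2) ^ (4 ∸ j))) (sym (^-assocʳ (ξ ^ 2) 2 n)) ⟩
  (𝟙 ⊖ ξ ⊗ ξ) ⊗ (ξ ^ n ⊗ (ξ ^ 2) ^ (4 ∸ j))
    ≡⟨ x∙yz≈y∙xz (𝟙 ⊖ ξ ⊗ ξ) (ξ ^ n) ((ξ ^ 2) ^ (4 ∸ j)) ⟩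
  ξ ^ n ⊗ ((𝟙 ⊖ ξ ⊗ ξ) ⊗ (ξ ^ 2) ^ (4 ∸ j))
    ≡⟨ cong (ξ ^ n ⊗_) ([1-ξ²]ξ²^[4-j]≡[ξ-1]ξ^[1+j] j≤3) ⟩
  ξ ^ n ⊗ ((ξ ⊖ 𝟙) ⊗ ξ ^ suc j)
    ≡⟨ x∙yz≈y∙xz (ξ ^ n) (ξ ⊖ 𝟙) (ξ ^ suc j) ⟩
  (ξ ⊖ 𝟙) ⊗ (ξ ^ n ⊗ ξ ^ suc j)
    ≡⟨ cong ((ξ ⊖ 𝟙) ⊗_) (sym (^-homo-⊗ ξ n (suc j))) ⟩
  (ξ ⊖ 𝟙) ⊗ ξ ^ (n + suc j)
    ≡⟨ cong (λ e → (ξ ⊖ 𝟙) ⊗ ξ ^ e) (+-suc n j) ⟩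
  (ξ ⊖ 𝟙) ⊗ ξ ^ suc (n + j)
    ∎
  where open ≡-Reasoning

lemma8 : (k j : ℕ) → 2 ≤ k → j ≤ 3 →
    (coeff (2 * k ∸ j) (((1- 𝟙 t) ^ₛ (k ∸ 2)) ⋆ ((1- ξ t) ^ₛ (k ∸ 1)) ⋆ (inv1- (ξ ^ 2) t))
    ≡ 3^ (k ∸ 2) ⊗ (ξ ⊖ 𝟙) ⊗ (ξ ^ (k + j ∸ 1)))
    × (coeff (2 * k ∸ j) (((1- 𝟙 t) ^ₛ (k ∸ 2)) ⋆ ((1- (ξ ^ 2) t) ^ₛ (k ∸ 1)) ⋆ (inv1- ξ t))
    ≡ 3^ (k ∸ 2) ⊗ (𝟙 ⊖ ξ) ⊗ (ξ ^ (2 * k ∸ j)))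
lemma8 (suc (suc n)) j (s≤s (s≤s z≤n)) j≤3 =
    trans (agrees (G-geometric ξ-root n) in-tail)
          (uv≈wx⇒yu∙v≈yw∙x ([1-ξ²]ξ²^[2k-j]≡[ξ-1]ξ^[k+j-1] n j≤3) (3^ n))
  , agrees (G-geometric ξ²-root n) in-tail
  where
  ξ-root : PrimitiveCubeRoot ξ
  ξ-root = refl
  ξ²-root : PrimitiveCubeRoot (ξ ^ 2)
  ξ²-root = refl
  in-tail : suc (2 * n) ≤ 2 * (2 + n) ∸ j
  in-tail = subst (suc (2 * n) ≤_) (sym (2[2+n]∸j≡2n+[4∸j] n (m≤n⇒m≤1+n j≤3)))
                  (m<m+n (2 * n) (m<n⇒0<n∸m (s≤s j≤3)))
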